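{- For every non-decreasing sort $\rho:d\to k^{\mathsf{u}}$, the collection $P(\rho)$ is closed under intersections: if $\mathcal{A},\mathcal{B}\in P(\rho)$ then $\mathcal{A}\cap\mathcal{B}\in P(\rho)$.
   Context: Setting: finite relational language $\mathcal{L}=\{U_i:i<k^{\mathsf{u}}\}\cup\{R_i:i<k\}$ with conventions: each vertex satisfies exactly one $U_i$ ($U(a)=i$); $R_i(a,a)$ never; distinct $a,b$ satisfy exactly one $R_i(a,b)$ ($R(a,b)=i$); an involution $\mathrm{Flip}$ of $k$ fixing $0$ with $R_i(a,b)\iff R_{\mathrm{Flip}(i)}(b,a)$; $R=0$ means no relation. $\mathcal{F}$ is a finite set of finite irreducible structures (irreducible: $R(a,b)\neq0$ for all distinct $a,b$), $\mathcal{K}=\mathrm{Forb}(\mathcal{F})$. Standing assumption: every $i<k^{\mathsf{u}}$ is non-degenerate (some two-element structure in $\mathcal{K}$ has a vertex of unary $i$ and a nonzero relation). $\mathbf{K}$ is a fixed enumerated left-dense Fra\"iss\'e limit of $\mathcal{K}$ (underlying set $\omega$; $\mathbf{K}_n$ = induced structure on $\{0,\dots,n-1\}$; left dense: for every enumerated $\mathbf{B}\in\mathcal{K}$ with $|\mathbf{B}|=m+1$, $\mathbf{B}_m=\mathbf{K}_m$, there is an order-preserving embedding $f$ fixing $\{0,\dots,m-1\}$ with $R(f(m),r)=0$ for $m\le r<f(m)$). $T=k^{\mathsf{u}}\times k^{<\omega}$; $T(n)$ = nodes $t=(t^{\mathsf{u}},t^{\mathsf{b}})$ with $|t^{\mathsf{b}}|=n$;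 $\preceq_{lex}$ compares unaries, then $t^{\mathsf{b}}$ lexicographically. Coding map $c(n)\in T(n)$, $c(n)^{\mathsf{u}}=U(n)$, $c(n)^{\mathsf{b}}(m)=R(n,m)$; $\mathrm{CT}(n)$ = set of restrictions to level $n$ of coding nodes. $\mathcal{L}_d$-structures: binary symbols plus unaries $V_0,\dots,V_{d-1}$ partitioning vertices ($V(b)=j$), underlying set disjoint from $\omega$. For $S=\{s_0\prec_{lex}\dots\prec_{lex}s_{d-1}\}\subseteq T(n)$, $\mathbf{B}[S]$ is the $\mathcal{L}$-structure on $\{0,\dots,n-1\}\cup B$ equal to $\mathbf{K}_n$ on $\{0,\dots,n-1\}$, with binary part of $\mathbf{B}$ on $B$, $U(b)=s_{V(b)}^{\mathsf{u}}$, $R(b,x)=s_{V(b)}^{\mathsf{b}}(x)$. $\mathcal{K}(S)=\{\mathbf{B}:\mathbf{B}[S]\in\mathcal{K}\}$, $S^{\mathsf{u}}(j)=s_j^{\mathsf{u}}$, and $P(\rho)=\{\mathcal{K}(S):n<\omega,\ S\subseteq\mathrm{CT}(n),\ S^{\mathsf{u}}=\rho\}$. -}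

module Defs where

open import Data.Nat using (ℕ; zero; suc; _+_; _≤_; _<_)
open import Data.Fin using (Fin; toℕ; inject₁; fromℕ; splitAt)
  renaming (_<_ to _<ᶠ_; _≤_ to _≤ᶠ_; zero to fzero; suc to fsuc)
open import Data.Product using (Σ; _×_; _,_; proj₁; proj₂)
open import Data.Sum using (_⊎_; inj₁; inj₂)
open import Data.List using (List)
open import Data.List.Membership.Propositional using (_∈_)
open import Relation.Binary.PropositionalEquality using (_≡_; _≢_)
open import Relation.Nullary using (¬_)
open import Function using (_∘_; _⇔_)
open import Function.Definitions using (Injective)
open import Level using (0ℓ)

-- Binary relation values: the paper's k is  suc k  here, so that the
-- value 0 ("no relation") always exists.

Bin : ℕ → Set
Bin k = Fin (suc k)

IsFlip : {k : ℕ} → (Bin k → Bin k) → Set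
IsFlip Flip = (∀ i → Flip (Flip i) ≡ i) × (Flip fzero ≡ fzero)

-- (Raw) finite structures on Fin m, with ku unary sorts and
-- Bin k binary values.  An L_d-structure is  Str d k m  (U plays V).

record Str (ku k m : ℕ) : Set where
  constructor mkStr
  field
    U : Fin m → Fin ku
    R : Fin m → Fin m → Bin k
open Str public

IsStr : {ku k m : ℕ} → (Bin k → Bin k) → Str ku k m → Set
IsStr Flip A = (∀ a → R A a a ≡ fzero) × (∀ a b → R A b a ≡ Flip (R A a b))

Irreducible : {ku k m : ℕ} → Str ku k m → Set
Irreducible A = ∀ a b → a ≢ b → R A a b ≢ fzero

Embeds : {ku k m m' : ℕ} → Str ku k m → Str ku k m' → Set
Embeds {m = m} {m'} A B =
  Σ (Fin m → Fin m') λ f → Injective _≡_ _≡_ f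
    × (∀ a → U B (f a) ≡ U A a)
    × (∀ a b → R B (f a) (f b) ≡ R A a b)

FinStr : ℕ → ℕ → Set
FinStr ku k = Σ ℕ (Str ku k)

In𝒦 : {ku k m : ℕ} → (Bin k → Bin k) → List (FinStr ku k) → Str ku k m → Set
In𝒦 Flip ℱ A = IsStr Flip A × (∀ F → F ∈ ℱ → ¬ Embeds (proj₂ F) A)

_≈S_ : {ku k m : ℕ} → Str ku k m → Str ku k m → Set
A ≈S B = (∀ a → U A a ≡ U B a) × (∀ a b → R A a b ≡ R B a b)

pullS : {ku k m m' : ℕ} → Str ku k m' → (Fin m → Fin m') → Str ku k m
pullS A f = mkStr (U A ∘ f) (λ a b → R A (f a) (f b))

record InfStr (ku k : ℕ) : Set where
  constructor mkInf
  field
    Uω : ℕ → Fin ku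
    Rω : ℕ → ℕ → Bin k
open InfStr public

IsInfStr : {ku k : ℕ} → (Bin k → Bin k) → InfStr ku k → Set
IsInfStr Flip K = (∀ a → Rω K a a ≡ fzero) × (∀ a b → Rω K b a ≡ Flip (Rω K a b))

pull : {ku k m : ℕ} → InfStr ku k → (Fin m → ℕ) → Str ku k m
pull K f = mkStr (Uω K ∘ f) (λ a b → Rω K (f a) (f b))

Kn : {ku k : ℕ} → InfStr ku k → (n : ℕ) → Str ku k n
Kn K n = pull K toℕ

snoc : {A : Set} {m : ℕ} → (Fin m → A) → A → Fin (suc m) → A
snoc {m = zero} f x fzero = x
snoc {m = suc m} f x fzero = f fzero
snoc {m = suc m} f x (fsuc i) = snoc (f ∘ fsuc) x i

-- Fraïssé limit of K: age(K) ⊆ K, K ⊆ age(K), and the extension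
-- property (equivalent to ultrahomogeneity for countable structures).
IsFraisseLimit : {ku k : ℕ} → (Bin k → Bin k) → List (FinStr ku k) → InfStr ku k → Set
IsFraisseLimit {ku} {k} Flip ℱ K =
  IsInfStr Flip K
  × (∀ m (f : Fin m → ℕ) → Injective _≡_ _≡_ f → In𝒦 Flip ℱ (pull K f))
  × (∀ m (B : Str ku k m) → In𝒦 Flip ℱ B →
       Σ (Fin m → ℕ) λ f → Injective _≡_ _≡_ f × (pull K f ≈S B))
  × (∀ m (f : Fin m → ℕ) → Injective _≡_ _≡_ f →
       (B : Str ku k (suc m)) → In𝒦 Flip ℱ B →
       pullS B inject₁ ≈S pull K f →
       Σ ℕ λ N → (∀ a → f a ≢ N) × (pull K (snoc f N) ≈S B))

LeftDense : {ku k : ℕ} → (Bin k → Bin k) → List (FinStr ku k) → InfStr ku k → Set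
LeftDense {ku} {k} Flip ℱ K =
  ∀ m (B : Str ku k (suc m)) → In𝒦 Flip ℱ B → pullS B inject₁ ≈S Kn K m →
    Σ (Fin (suc m) → ℕ) λ f →
        (∀ i j → i <ᶠ j → f i < f j)
      × (∀ (i : Fin m) → f (inject₁ i) ≡ toℕ i)
      × (pull K f ≈S B)
      × (∀ r → m ≤ r → r < f (fromℕ m) → Rω K (f (fromℕ m)) r ≡ fzero)

NonDegenerate : {ku k : ℕ} → (Bin k → Bin k) → List (FinStr ku k) → Set
NonDegenerate {ku} {k} Flip ℱ =
  ∀ (i : Fin ku) → Σ (Str ku k 2) λ B → In𝒦 Flip ℱ B
    × Σ (Fin 2) λ a → Σ (Fin 2) λ b → (U B a ≡ i) × (R B a b ≢ fzero)

-- The tree T = ku × k^{<ω}; level n.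

Node : ℕ → ℕ → ℕ → Set
Node ku k n = Fin ku × (Fin n → Bin k)

_≺lex_ : {ku k n : ℕ} → Node ku k n → Node ku k n → Set
_≺lex_ {n = n} (u , b) (u' , b') =
  (u <ᶠ u') ⊎ ((u ≡ u') × Σ (Fin n) λ i → (∀ j → j <ᶠ i → b j ≡ b' j) × (b i <ᶠ b' i))

-- t ∈ CT(n): t is the restriction to level n of some coding node c(N), N ≥ n
InCT : {ku k : ℕ} → InfStr ku k → (n : ℕ) → Node ku k n → Set
InCT K n (u , b) = Σ ℕ λ N → (n ≤ N) × (u ≡ Uω K N) × (∀ i → b i ≡ Rω K N (toℕ i))

ValidS : {ku k d : ℕ} → InfStr ku k → (ρ : Fin d → Fin ku) → (n : ℕ) →
         (Fin d → Node ku k n) → Set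
ValidS K ρ n s =
    (∀ i j → i <ᶠ j → s i ≺lex s j)
  × (∀ j → InCT K n (s j))
  × (∀ j → proj₁ (s j) ≡ ρ j)

-- B[S]: the L-structure on {0..n-1} ∪ B  (realised on Fin (n + m))
B[_] : {ku k d n m : ℕ} → (Bin k → Bin k) → InfStr ku k →
       (Fin d → Node ku k n) → Str d k m → Str ku k (n + m)
B[_] {n = n} Flip K s B = mkStr u r
  where
  u : Fin (n + _) → Fin _
  u x with splitAt n x
  ... | inj₁ i = Uω K (toℕ i)
  ... | inj₂ b = proj₁ (s (U B b))
  r : Fin (n + _) → Fin (n + _) → Bin _
  r x y with splitAt n x | splitAt n y
  ... | inj₁ i | inj₁ j = Rω K (toℕ i) (toℕ j)
  ... | inj₂ b | inj₁ j = proj₂ (s (U B b)) j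
  ... | inj₁ i | inj₂ b = Flip (proj₂ (s (U B b)) i)
  ... | inj₂ b | inj₂ b' = R B b b'

Class : ℕ → ℕ → Set₁
Class d k = ∀ m → Str d k m → Set

𝒦[_] : {ku k d n : ℕ} → (Bin k → Bin k) → List (FinStr ku k) → InfStr ku k →
       (Fin d → Node ku k n) → Class d k
𝒦[_] Flip ℱ K s m B = IsStr Flip B × In𝒦 Flip ℱ (B[_] Flip K s B)

_≐_ : {d k : ℕ} → Class d k → Class d k → Set
𝒜 ≐ 𝓑 = ∀ m B → 𝒜 m B ⇔ 𝓑 m B

_∩_ : {d k : ℕ} → Class d k → Class d k → Class d k
(𝒜 ∩ 𝓑) m B = 𝒜 m B × 𝓑 m B

InP : {ku k d : ℕ} → (Bin k → Bin k) → List (FinStr ku k) → InfStr ku k →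
      (Fin d → Fin ku) → Class d k → Set
InP {ku} {k} {d} Flip ℱ K ρ 𝒜 =
  Σ ℕ λ n → Σ (Fin d → Node ku k n) λ s →
    ValidS K ρ n s × (𝒜 ≐ 𝒦[_] Flip ℱ K s)

NonDecreasing : {d ku : ℕ} → (Fin d → Fin ku) → Set
NonDecreasing ρ = ∀ i j → i ≤ᶠ j → ρ i ≤ᶠ ρ j

-- Given S ⊆ CT(n) and S′ ⊆ CT(n′) of sort ρ, embed the free sum K_n ⊕ K into K over K_n, one
-- point at a time by the extension property; this yields a copy of K_{n′} in K with no relations
-- to K_n.  At a level L above that copy merge the two families: the j-th new node agrees with s_j
-- on K_n, with s′_j on the copy of K_{n′}, and is 0 elsewhere.  Then B[S ⊔ S′] contains B[S] and
-- B[S′], and since forbidden structures are irreducible, a forbidden substructure of B[S ⊔ S′]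
-- would lie inside K_L, B[S] or B[S′]; hence 𝒦(S ⊔ S′) = 𝒦(S) ∩ 𝒦(S′).  The merged nodes inherit
-- the lexicographic order from S, and they are coding nodes because a node lies in CT(L) exactly
-- when its one-point structure over K_L is in 𝒦.

module Submission where

open import Defs
open import Data.Nat using (ℕ; zero; suc; _+_; _∸_; _≤_; _<_; _<?_; _≤?_)
open import Data.Nat.Properties
  using (<-trans; <-≤-trans; <-irrefl; <⇒≱; ≮⇒≥; <-≤-connex; m≤m+n; m≤n+m; m+n∸m≡n;
         ∸-cancelʳ-≡; +-monoʳ-<; +-comm; +-cancelˡ-≡)
open import Data.Fin using (Fin; toℕ; fromℕ; fromℕ<; inject₁; inject≤; splitAt; cast; _↑ˡ_; _↑ʳ_)
  renaming (zero to fzero; suc to fsuc; _<_ to _<ᶠ_; _≟_ to _≟ᶠ_)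
open import Data.Fin.Properties
  using (toℕ-injective; toℕ<n; toℕ-fromℕ<; toℕ-fromℕ; toℕ-inject₁; toℕ-inject≤; inject≤-injective;
         toℕ-cast; toℕ-↑ˡ; toℕ-↑ʳ; ↑ˡ-injective; ↑ʳ-injective; splitAt-↑ˡ; splitAt-↑ʳ;
         splitAt⁻¹-↑ˡ; splitAt⁻¹-↑ʳ; all?; any?; ¬∀⟶∃¬)
open import Data.Fin.Relation.Unary.Top using (view; ‵fromℕ; ‵inject₁)
open import Data.Product using (Σ; ∃; _×_; _,_; proj₁; proj₂)
open import Data.Product.Function.NonDependent.Propositional using (_×-⇔_)
open import Data.Sum using (_⊎_; inj₁; inj₂; [_,_]′)
open import Data.Empty using (⊥-elim)
open import Data.List using (List)
open import Data.List.Membership.Propositional using (_∈_)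
open import Data.List.Relation.Unary.All using (All; lookup)
open import Relation.Binary.PropositionalEquality
open import Relation.Nullary using (¬_; yes; no)
open import Relation.Nullary.Decidable using (_⊎-dec_)
open import Relation.Unary using (Pred; Decidable)
open import Function using (_∘_; mk⇔)
open import Function.Definitions using (Injective)
open import Function.Properties.Equivalence using () renaming (trans to ⇔-trans)
open import Level using (0ℓ)

Image : ∀ {m m′} → (Fin m → Fin m′) → Pred (Fin m′) 0ℓ
Image f x = ∃ λ y → f y ≡ x

image? : ∀ {m m′} (f : Fin m → Fin m′) → Decidable (Image f)
image? f x = any? (λ y → f y ≟ᶠ x)

module _ {ku k : ℕ} where

  Embeds-trans : ∀ {p m m′} {F : Str ku k p} {A : Str ku k m} {C : Str ku k m′} →
    Embeds F A → Embeds A C → Embeds F C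
  Embeds-trans (e , e-inj , eU , eR) (f , f-inj , fU , fR) =
    f ∘ e , e-inj ∘ f-inj , (λ a → trans (fU (e a)) (eU a)) , (λ a b → trans (fR (e a) (e b)) (eR a b))

  Embeds-factor : ∀ {p m m′} {F : Str ku k p} {A : Str ku k m} {C : Str ku k m′} →
    (E : Embeds F C) (G : Embeds A C) → (∀ a → Image (proj₁ G) (proj₁ E a)) → Embeds F A
  Embeds-factor {C = C} (e , e-inj , eU , eR) (f , f-inj , fU , fR) pre =
    pre₁ , (λ eq → e-inj (trans (sym (pre₂ _)) (trans (cong f eq) (pre₂ _)))) ,
    (λ a → trans (sym (fU (pre₁ a))) (trans (cong (U C) (pre₂ a)) (eU a))) ,
    (λ a b → trans (sym (fR (pre₁ a) (pre₁ b))) (trans (cong₂ (R C) (pre₂ a) (pre₂ b)) (eR a b)))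
    where
    pre₁ = λ a → proj₁ (pre a)
    pre₂ = λ a → proj₂ (pre a)

  pullS-embeds : ∀ {m m′} (A : Str ku k m′) {f : Fin m → Fin m′} →
    Injective _≡_ _≡_ f → Embeds (pullS A f) A
  pullS-embeds A {f} f-inj = f , f-inj , (λ _ → refl) , (λ _ _ → refl)

  pullS-isStr : ∀ {Flip : Bin k → Bin k} {m m′} {A : Str ku k m′} (f : Fin m → Fin m′) →
    IsStr Flip A → IsStr Flip (pullS A f)
  pullS-isStr f (A-irrefl , A-flip) = (λ a → A-irrefl (f a)) , (λ a b → A-flip (f a) (f b))

  Irreducible-one-side : ∀ {p m} {F : Str ku k p} {C : Str ku k m} → Irreducible F → (E : Embeds F C) →
    {P Q : Pred (Fin m) 0ℓ} → Decidable P → Decidable Q →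
    (∀ a → P (proj₁ E a) ⊎ Q (proj₁ E a)) →
    (∀ x y → Q x → ¬ P x → P y → ¬ Q y → R C x y ≡ fzero) →
    (∀ a → P (proj₁ E a)) ⊎ (∀ a → Q (proj₁ E a))
  Irreducible-one-side irr (e , _ , _ , eR) {P} {Q} P? Q? cover free
    with all? (P? ∘ e) | all? (Q? ∘ e)
  ... | yes allP | _ = inj₁ allP
  ... | no _ | yes allQ = inj₂ allQ
  ... | no notAllP | no notAllQ = ⊥-elim (irr a b a≢b (trans (sym (eR a b)) (free _ _ Qa ¬Pa Pb ¬Qb)))
    where
    a = proj₁ (¬∀⟶∃¬ _ _ (P? ∘ e) notAllP)
    ¬Pa = proj₂ (¬∀⟶∃¬ _ _ (P? ∘ e) notAllP)
    b = proj₁ (¬∀⟶∃¬ _ _ (Q? ∘ e) notAllQ)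
    ¬Qb = proj₂ (¬∀⟶∃¬ _ _ (Q? ∘ e) notAllQ)
    Qa = [ ⊥-elim ∘ ¬Pa , (λ q → q) ]′ (cover a)
    Pb = [ (λ p → p) , ⊥-elim ∘ ¬Qb ]′ (cover b)
    a≢b : a ≢ b
    a≢b a≡b = ¬Pa (subst (P ∘ e) (sym a≡b) Pb)

module _ {ku k : ℕ} (Flip : Bin k → Bin k) (ℱ : List (FinStr ku k)) where

  AgeIn𝒦 : InfStr ku k → Set
  AgeIn𝒦 A = ∀ m (f : Fin m → ℕ) → Injective _≡_ _≡_ f → In𝒦 Flip ℱ (pull A f)

  HasExtension : InfStr ku k → Set
  HasExtension K = ∀ m (f : Fin m → ℕ) → Injective _≡_ _≡_ f →
    (B : Str ku k (suc m)) → In𝒦 Flip ℱ B → pullS B inject₁ ≈S pull K f →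
    Σ ℕ λ N → (∀ a → f a ≢ N) × (pull K (snoc f N) ≈S B)

module _ {ku k : ℕ} {Flip : Bin k → Bin k} {ℱ : List (FinStr ku k)} where

  In𝒦-hereditary : ∀ {m m′} {A : Str ku k m} {C : Str ku k m′} →
    IsStr Flip A → Embeds A C → In𝒦 Flip ℱ C → In𝒦 Flip ℱ A
  In𝒦-hereditary {C = C} A-str A↪C (_ , C-free) =
    A-str , λ F F∈ F↪A → C-free F F∈ (Embeds-trans {C = C} F↪A A↪C)


data Split (n m : ℕ) : Fin (n + m) → Set where
  old : (i : Fin n) → Split n m (i ↑ˡ m)
  new : (b : Fin m) → Split n m (n ↑ʳ b)

split : ∀ n {m} (x : Fin (n + m)) → Split n m x
split n x with splitAt n x in eq
... | inj₁ i = subst (Split n _) (splitAt⁻¹-↑ˡ eq) (old i)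
... | inj₂ b = subst (Split n _) (splitAt⁻¹-↑ʳ eq) (new b)

↑ˡ≢↑ʳ : ∀ {n m} (i : Fin n) (b : Fin m) → i ↑ˡ m ≢ n ↑ʳ b
↑ˡ≢↑ʳ {n} {m} i b eq with trans (sym (splitAt-↑ˡ n i m)) (trans (cong (splitAt n) eq) (splitAt-↑ʳ n m b))
... | ()

caseSplit : ∀ {A : Set} n {m} → (Fin n → A) → (Fin m → A) → Fin (n + m) → A
caseSplit n f g x = [ f , g ]′ (splitAt n x)

caseSplit-↑ˡ : ∀ {A : Set} {n m} (f : Fin n → A) (g : Fin m → A) i → caseSplit n f g (i ↑ˡ m) ≡ f i
caseSplit-↑ˡ {n = n} {m} f g i rewrite splitAt-↑ˡ n i m = refl

caseSplit-↑ʳ : ∀ {A : Set} {n m} (f : Fin n → A) (g : Fin m → A) b → caseSplit n f g (n ↑ʳ b) ≡ g b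
caseSplit-↑ʳ {n = n} {m} f g b rewrite splitAt-↑ʳ n m b = refl

module B[]-values {ku k d n m : ℕ} (Flip : Bin k → Bin k) (K : InfStr ku k)
                  (s : Fin d → Node ku k n) (B : Str d k m) where

  private
    C = B[_] Flip K s B

  U-↑ˡ : ∀ i → U C (i ↑ˡ m) ≡ Uω K (toℕ i)
  U-↑ˡ i rewrite splitAt-↑ˡ n i m = refl

  U-↑ʳ : ∀ b → U C (n ↑ʳ b) ≡ proj₁ (s (U B b))
  U-↑ʳ b rewrite splitAt-↑ʳ n m b = refl

  R-↑ˡ↑ˡ : ∀ i j → R C (i ↑ˡ m) (j ↑ˡ m) ≡ Rω K (toℕ i) (toℕ j)
  R-↑ˡ↑ˡ i j rewrite splitAt-↑ˡ n i m | splitAt-↑ˡ n j m = refl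

  R-↑ʳ↑ˡ : ∀ b j → R C (n ↑ʳ b) (j ↑ˡ m) ≡ proj₂ (s (U B b)) j
  R-↑ʳ↑ˡ b j rewrite splitAt-↑ʳ n m b | splitAt-↑ˡ n j m = refl

  R-↑ˡ↑ʳ : ∀ i b → R C (i ↑ˡ m) (n ↑ʳ b) ≡ Flip (proj₂ (s (U B b)) i)
  R-↑ˡ↑ʳ i b rewrite splitAt-↑ʳ n m b | splitAt-↑ˡ n i m = refl

  R-↑ʳ↑ʳ : ∀ b b′ → R C (n ↑ʳ b) (n ↑ʳ b′) ≡ R B b b′
  R-↑ʳ↑ʳ b b′ rewrite splitAt-↑ʳ n m b | splitAt-↑ʳ n m b′ = refl

module _ {ku k d n m : ℕ} {Flip : Bin k → Bin k} {K : InfStr ku k}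
         {s : Fin d → Node ku k n} {B : Str d k m} where
  open B[]-values Flip K s B

  B[]-isStr : IsFlip Flip → IsInfStr Flip K → IsStr Flip B → IsStr Flip (B[_] Flip K s B)
  B[]-isStr (Flip-invol , _) (K-irrefl , K-flip) (B-irrefl , B-flip) = irrefl , flip
    where
    C = B[_] Flip K s B
    irrefl : ∀ x → R C x x ≡ fzero
    irrefl x with split n x
    ... | old i = trans (R-↑ˡ↑ˡ i i) (K-irrefl (toℕ i))
    ... | new b = trans (R-↑ʳ↑ʳ b b) (B-irrefl b)
    flip : ∀ x y → R C y x ≡ Flip (R C x y)
    flip x y with split n x | split n y
    ... | old i | old j rewrite R-↑ˡ↑ˡ i j | R-↑ˡ↑ˡ j i = K-flip (toℕ i) (toℕ j)
    ... | old i | new b rewrite R-↑ˡ↑ʳ i b | R-↑ʳ↑ˡ b i = sym (Flip-invol _)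
    ... | new b | old j rewrite R-↑ˡ↑ʳ j b | R-↑ʳ↑ˡ b j = refl
    ... | new b | new b′ rewrite R-↑ʳ↑ʳ b b′ | R-↑ʳ↑ʳ b′ b = B-flip b b′

mapOld : ∀ {n₁ n₂} m → (Fin n₁ → Fin n₂) → Fin (n₁ + m) → Fin (n₂ + m)
mapOld {n₁} {n₂} m φ = caseSplit n₁ (λ i → φ i ↑ˡ m) (n₂ ↑ʳ_)

mapOld-↑ˡ : ∀ {n₁ n₂} m (φ : Fin n₁ → Fin n₂) i → mapOld m φ (i ↑ˡ m) ≡ φ i ↑ˡ m
mapOld-↑ˡ {n₂ = n₂} m φ = caseSplit-↑ˡ (λ i → φ i ↑ˡ m) (n₂ ↑ʳ_)

mapOld-↑ʳ : ∀ {n₁ n₂} m (φ : Fin n₁ → Fin n₂) b → mapOld {n₂ = n₂} m φ (n₁ ↑ʳ b) ≡ n₂ ↑ʳ b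
mapOld-↑ʳ {n₂ = n₂} m φ = caseSplit-↑ʳ (λ i → φ i ↑ˡ m) (n₂ ↑ʳ_)

B[]-mono : ∀ {ku k d n₁ n₂ m} {Flip : Bin k → Bin k} {K : InfStr ku k}
  {s₁ : Fin d → Node ku k n₁} {s₂ : Fin d → Node ku k n₂} (B : Str d k m) →
  (Φ : Embeds (Kn K n₁) (Kn K n₂)) →
  (∀ j → proj₁ (s₂ j) ≡ proj₁ (s₁ j)) → (∀ j a → proj₂ (s₂ j) (proj₁ Φ a) ≡ proj₂ (s₁ j) a) →
  Embeds (B[_] Flip K s₁ B) (B[_] Flip K s₂ B)
B[]-mono {n₁ = n₁} {n₂} {m} {Flip} {K} {s₁} {s₂} B (φ , φ-inj , φU , φR) same-unary same-binary =
  φ̂ , injective , preservesU , preservesR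
  where
  module C₁ = B[]-values Flip K s₁ B
  module C₂ = B[]-values Flip K s₂ B
  φ̂ = mapOld m φ
  φ̂-↑ˡ = mapOld-↑ˡ m φ
  φ̂-↑ʳ = mapOld-↑ʳ {n₂ = n₂} m φ
  injective : Injective _≡_ _≡_ φ̂
  injective {x} {y} eq with split n₁ x | split n₁ y
  ... | old i | old j rewrite φ̂-↑ˡ i | φ̂-↑ˡ j = cong (_↑ˡ m) (φ-inj (↑ˡ-injective m _ _ eq))
  ... | old i | new c rewrite φ̂-↑ˡ i | φ̂-↑ʳ c = ⊥-elim (↑ˡ≢↑ʳ _ _ eq)
  ... | new c | old j rewrite φ̂-↑ˡ j | φ̂-↑ʳ c = ⊥-elim (↑ˡ≢↑ʳ _ _ (sym eq))
  ... | new c | new c′ rewrite φ̂-↑ʳ c | φ̂-↑ʳ c′ = cong (n₁ ↑ʳ_) (↑ʳ-injective n₂ _ _ eq)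
  preservesU : ∀ x → U (B[_] Flip K s₂ B) (φ̂ x) ≡ U (B[_] Flip K s₁ B) x
  preservesU x with split n₁ x
  ... | old i rewrite φ̂-↑ˡ i | C₂.U-↑ˡ (φ i) | C₁.U-↑ˡ i = φU i
  ... | new b rewrite φ̂-↑ʳ b | C₂.U-↑ʳ b | C₁.U-↑ʳ b = same-unary (U B b)
  preservesR : ∀ x y → R (B[_] Flip K s₂ B) (φ̂ x) (φ̂ y) ≡ R (B[_] Flip K s₁ B) x y
  preservesR x y with split n₁ x | split n₁ y
  ... | old i | old j rewrite φ̂-↑ˡ i | φ̂-↑ˡ j | C₂.R-↑ˡ↑ˡ (φ i) (φ j) | C₁.R-↑ˡ↑ˡ i j = φR i j
  ... | old i | new c rewrite φ̂-↑ˡ i | φ̂-↑ʳ c | C₂.R-↑ˡ↑ʳ (φ i) c | C₁.R-↑ˡ↑ʳ i c =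
    cong Flip (same-binary (U B c) i)
  ... | new c | old j rewrite φ̂-↑ˡ j | φ̂-↑ʳ c | C₂.R-↑ʳ↑ˡ c (φ j) | C₁.R-↑ʳ↑ˡ c j = same-binary (U B c) j
  ... | new c | new c′ rewrite φ̂-↑ʳ c | φ̂-↑ʳ c′ | C₂.R-↑ʳ↑ʳ c c′ | C₁.R-↑ʳ↑ʳ c c′ = refl

module _ {ku k : ℕ} where

  _⊕[_]_ : InfStr ku k → ℕ → InfStr ku k → InfStr ku k
  A ⊕[ n ] B = mkInf U⊕ R⊕
    where
    U⊕ : ℕ → Fin ku
    U⊕ x with x <? n
    ... | yes _ = Uω A x
    ... | no _ = Uω B (x ∸ n)
    R⊕ : ℕ → ℕ → Bin k
    R⊕ x y with x <? n | y <? n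
    ... | yes _ | yes _ = Rω A x y
    ... | no _ | no _ = Rω B (x ∸ n) (y ∸ n)
    ... | _ | _ = fzero

  module _ (A : InfStr ku k) (n : ℕ) (B : InfStr ku k) where

    ⊕-U-below : ∀ {x} → x < n → Uω (A ⊕[ n ] B) x ≡ Uω A x
    ⊕-U-below {x} x<n with x <? n
    ... | yes _ = refl
    ... | no x≮n = ⊥-elim (x≮n x<n)

    ⊕-U-above : ∀ {x} → n ≤ x → Uω (A ⊕[ n ] B) x ≡ Uω B (x ∸ n)
    ⊕-U-above {x} n≤x with x <? n
    ... | yes x<n = ⊥-elim (<⇒≱ x<n n≤x)
    ... | no _ = refl

    ⊕-R-below : ∀ {x y} → x < n → y < n → Rω (A ⊕[ n ] B) x y ≡ Rω A x y
    ⊕-R-below {x} {y} x<n y<n with x <? n | y <? n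
    ... | yes _ | yes _ = refl
    ... | no x≮n | _ = ⊥-elim (x≮n x<n)
    ... | yes _ | no y≮n = ⊥-elim (y≮n y<n)

    ⊕-R-above : ∀ {x y} → n ≤ x → n ≤ y → Rω (A ⊕[ n ] B) x y ≡ Rω B (x ∸ n) (y ∸ n)
    ⊕-R-above {x} {y} n≤x n≤y with x <? n | y <? n
    ... | no _ | no _ = refl
    ... | yes x<n | _ = ⊥-elim (<⇒≱ x<n n≤x)
    ... | no _ | yes y<n = ⊥-elim (<⇒≱ y<n n≤y)

    ⊕-R-below-above : ∀ {x y} → x < n → n ≤ y → Rω (A ⊕[ n ] B) x y ≡ fzero
    ⊕-R-below-above {x} {y} x<n n≤y with x <? n | y <? n
    ... | yes _ | no _ = refl
    ... | no x≮n | _ = ⊥-elim (x≮n x<n)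
    ... | yes _ | yes y<n = ⊥-elim (<⇒≱ y<n n≤y)

    ⊕-R-above-below : ∀ {x y} → n ≤ x → y < n → Rω (A ⊕[ n ] B) x y ≡ fzero
    ⊕-R-above-below {x} {y} n≤x y<n with x <? n | y <? n
    ... | no _ | yes _ = refl
    ... | yes x<n | _ = ⊥-elim (<⇒≱ x<n n≤x)
    ... | no _ | no y≮n = ⊥-elim (y≮n y<n)

module _ {ku k : ℕ} {Flip : Bin k → Bin k} {A B : InfStr ku k} {n : ℕ} where

  ⊕-isInfStr : IsFlip Flip → IsInfStr Flip A → IsInfStr Flip B → IsInfStr Flip (A ⊕[ n ] B)
  ⊕-isInfStr (_ , Flip-0) (A-irrefl , A-flip) (B-irrefl , B-flip) = irrefl , flip
    where
    D = A ⊕[ n ] B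
    irrefl : ∀ x → Rω D x x ≡ fzero
    irrefl x with <-≤-connex x n
    ... | inj₁ x<n = trans (⊕-R-below A n B x<n x<n) (A-irrefl x)
    ... | inj₂ n≤x = trans (⊕-R-above A n B n≤x n≤x) (B-irrefl (x ∸ n))
    flip : ∀ x y → Rω D y x ≡ Flip (Rω D x y)
    flip x y with <-≤-connex x n | <-≤-connex y n
    ... | inj₁ x<n | inj₁ y<n rewrite ⊕-R-below A n B x<n y<n | ⊕-R-below A n B y<n x<n = A-flip x y
    ... | inj₁ x<n | inj₂ n≤y rewrite ⊕-R-below-above A n B x<n n≤y | ⊕-R-above-below A n B n≤y x<n =
      sym Flip-0
    ... | inj₂ n≤x | inj₁ y<n rewrite ⊕-R-above-below A n B n≤x y<n | ⊕-R-below-above A n B y<n n≤x =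
      sym Flip-0
    ... | inj₂ n≤x | inj₂ n≤y rewrite ⊕-R-above A n B n≤x n≤y | ⊕-R-above A n B n≤y n≤x =
      B-flip (x ∸ n) (y ∸ n)

  ⊕-In𝒦 : {ℱ : List (FinStr ku k)} → IsFlip Flip → (∀ {F} → F ∈ ℱ → Irreducible (proj₂ F)) →
    IsInfStr Flip A → IsInfStr Flip B → AgeIn𝒦 Flip ℱ A → AgeIn𝒦 Flip ℱ B →
    ∀ t → In𝒦 Flip ℱ (Kn (A ⊕[ n ] B) t)
  ⊕-In𝒦 {ℱ} fl irreducible A-str B-str A-age B-age t = D-str , free
    where
    D = A ⊕[ n ] B
    D-str : IsStr Flip (Kn D t)
    D-str = (λ a → proj₁ (⊕-isInfStr fl A-str B-str) (toℕ a)) ,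
            (λ a b → proj₂ (⊕-isInfStr fl A-str B-str) (toℕ a) (toℕ b))
    free : ∀ F → F ∈ ℱ → ¬ Embeds (proj₂ F) (Kn D t)
    free F F∈ E@(e , e-inj , eU , eR)
      with Irreducible-one-side {C = Kn D t} (irreducible F∈) E {P = λ x → toℕ x < n} {Q = λ x → n ≤ toℕ x}
             (λ x → toℕ x <? n) (λ x → n ≤? toℕ x) (λ a → <-≤-connex (toℕ (e a)) n)
             (λ x y n≤x _ y<n _ → ⊕-R-above-below A n B n≤x y<n)
    ... | inj₁ below = proj₂ (A-age _ h (e-inj ∘ toℕ-injective)) F F∈
            ((λ a → a) , (λ eq → eq) ,
             (λ a → trans (sym (⊕-U-below A n B (below a))) (eU a)) ,
             (λ a b → trans (sym (⊕-R-below A n B (below a) (below b))) (eR a b)))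
      where h = toℕ ∘ e
    ... | inj₂ above = proj₂ (B-age _ h (e-inj ∘ toℕ-injective ∘ ∸-cancelʳ-≡ (above _) (above _))) F F∈
            ((λ a → a) , (λ eq → eq) ,
             (λ a → trans (sym (⊕-U-above A n B (above a))) (eU a)) ,
             (λ a b → trans (sym (⊕-R-above A n B (above a) (above b))) (eR a b)))
      where h = λ a → toℕ (e a) ∸ n

module _ {A : Set} where

  snoc-inject₁ : ∀ {m} (f : Fin m → A) x i → snoc f x (inject₁ i) ≡ f i
  snoc-inject₁ {suc m} f x fzero = refl
  snoc-inject₁ {suc m} f x (fsuc i) = snoc-inject₁ (f ∘ fsuc) x i

  snoc-fromℕ : ∀ {m} (f : Fin m → A) x → snoc f x (fromℕ m) ≡ x
  snoc-fromℕ {zero} f x = refl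
  snoc-fromℕ {suc m} f x = snoc-fromℕ (f ∘ fsuc) x

  snoc-injective : ∀ {m} {f : Fin m → A} {x} → Injective _≡_ _≡_ f → (∀ a → f a ≢ x) →
    Injective _≡_ _≡_ (snoc f x)
  snoc-injective {m} {f} {x} f-inj fresh {i} {j} eq with view i | view j
  ... | ‵fromℕ | ‵fromℕ = refl
  ... | ‵fromℕ | ‵inject₁ b =
    ⊥-elim (fresh b (trans (sym (snoc-inject₁ f x b)) (trans (sym eq) (snoc-fromℕ f x))))
  ... | ‵inject₁ a | ‵fromℕ =
    ⊥-elim (fresh a (trans (sym (snoc-inject₁ f x a)) (trans eq (snoc-fromℕ f x))))
  ... | ‵inject₁ a | ‵inject₁ b =
    cong inject₁ (f-inj (trans (sym (snoc-inject₁ f x a)) (trans eq (snoc-inject₁ f x b))))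

module _ {ku k : ℕ} {Flip : Bin k → Bin k} {ℱ : List (FinStr ku k)} {K : InfStr ku k}
         (ext : HasExtension Flip ℱ K) (D : InfStr ku k) (D-age : ∀ t → In𝒦 Flip ℱ (Kn D t))
         (n : ℕ) (K≈D : Kn K n ≈S Kn D n) where

  record EmbeddingOver (t : ℕ) : Set where
    field
      map : Fin t → ℕ
      injective : Injective _≡_ _≡_ map
      realizes : pull K map ≈S Kn D t
      fixes-below : ∀ i → toℕ i < n → map i ≡ toℕ i

  EmbeddingOver-extend : ∀ {t} → n ≤ t → EmbeddingOver t → EmbeddingOver (suc t)
  EmbeddingOver-extend {t} n≤t f = record
    { map = snoc map N
    ; injective = snoc-injective injective N-fresh
    ; realizes = N-realizes
    ; fixes-below = fixes-below′
    }
    where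
    open EmbeddingOver f
    agree : pullS (Kn D (suc t)) inject₁ ≈S pull K map
    agree = (λ a → trans (cong (Uω D) (toℕ-inject₁ a)) (sym (proj₁ realizes a))) ,
            (λ a b → trans (cong₂ (Rω D) (toℕ-inject₁ a) (toℕ-inject₁ b)) (sym (proj₂ realizes a b)))
    extension = ext t map injective (Kn D (suc t)) (D-age (suc t)) agree
    N = proj₁ extension
    N-fresh = proj₁ (proj₂ extension)
    N-realizes = proj₂ (proj₂ extension)
    fixes-below′ : ∀ i → toℕ i < n → snoc map N i ≡ toℕ i
    fixes-below′ i i<n with view i
    ... | ‵fromℕ = ⊥-elim (<⇒≱ (subst (_< n) (toℕ-fromℕ t) i<n) n≤t)
    ... | ‵inject₁ j = begin
      snoc map N (inject₁ j) ≡⟨ snoc-inject₁ map N j ⟩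
      map j                  ≡⟨ fixes-below j (subst (_< n) (toℕ-inject₁ j) i<n) ⟩
      toℕ j                  ≡⟨ sym (toℕ-inject₁ j) ⟩
      toℕ (inject₁ j)        ∎
      where open ≡-Reasoning

  embeddingOver : ∀ u → EmbeddingOver (u + n)
  embeddingOver zero = record
    { map = toℕ ; injective = toℕ-injective ; realizes = K≈D ; fixes-below = λ _ _ → refl }
  embeddingOver (suc u) = EmbeddingOver-extend (m≤n+m n u) (embeddingOver u)

point : ∀ {d k} → Fin d → Str d k 1
point j = mkStr (λ _ → j) (λ _ _ → fzero)

point-isStr : ∀ {d k} {Flip : Bin k → Bin k} {j : Fin d} → IsFlip Flip → IsStr Flip (point j)
point-isStr (_ , Flip-0) = (λ _ → refl) , (λ _ _ → sym Flip-0)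

module _ {ku k d : ℕ} {Flip : Bin k → Bin k} {ℱ : List (FinStr ku k)} {K : InfStr ku k}
         (fl : IsFlip Flip) (K-str : IsInfStr Flip K)
         {n : ℕ} (s : Fin d → Node ku k n) (j : Fin d) where

  private
    C = B[_] Flip K s (point {k = k} j)
    C-str : IsStr Flip C
    C-str = B[]-isStr {Flip = Flip} {K = K} {s = s} fl K-str (point-isStr {Flip = Flip} {j = j} fl)
  open B[]-values Flip K s (point {k = k} j)

  InCT⇒point∈𝒦 : AgeIn𝒦 Flip ℱ K → InCT K n (s j) → In𝒦 Flip ℱ C
  InCT⇒point∈𝒦 K-age (N , n≤N , N-unary , N-binary) =
    In𝒦-hereditary {Flip = Flip} {ℱ = ℱ} {C = pull K h} C-str ((λ x → x) , (λ eq → eq) , h-U , h-R)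
      (K-age (n + 1) h h-injective)
    where
    h : Fin (n + 1) → ℕ
    h = caseSplit n toℕ (λ _ → N)
    h-↑ˡ : ∀ i → h (i ↑ˡ 1) ≡ toℕ i
    h-↑ˡ = caseSplit-↑ˡ toℕ (λ _ → N)
    h-↑ʳ : ∀ b → h (n ↑ʳ b) ≡ N
    h-↑ʳ = caseSplit-↑ʳ {n = n} toℕ (λ _ → N)
    old≢N : ∀ i → toℕ i ≢ N
    old≢N i eq = <-irrefl eq (<-≤-trans (toℕ<n i) n≤N)
    h-injective : Injective _≡_ _≡_ h
    h-injective {x} {y} eq with split n x | split n y
    ... | old i | old i′ = cong (_↑ˡ 1) (toℕ-injective (trans (sym (h-↑ˡ i)) (trans eq (h-↑ˡ i′))))
    ... | old i | new _ = ⊥-elim (old≢N i (trans (sym (h-↑ˡ i)) (trans eq (h-↑ʳ _))))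
    ... | new _ | old i = ⊥-elim (old≢N i (trans (sym (h-↑ˡ i)) (trans (sym eq) (h-↑ʳ _))))
    ... | new fzero | new fzero = refl
    h-U : ∀ x → Uω K (h x) ≡ U C x
    h-U x with split n x
    ... | old i rewrite h-↑ˡ i = sym (U-↑ˡ i)
    ... | new b rewrite h-↑ʳ b | U-↑ʳ b = sym N-unary
    h-R : ∀ x y → Rω K (h x) (h y) ≡ R C x y
    h-R x y with split n x | split n y
    ... | old i | old i′ rewrite h-↑ˡ i | h-↑ˡ i′ = sym (R-↑ˡ↑ˡ i i′)
    ... | old i | new b rewrite h-↑ˡ i | h-↑ʳ b | R-↑ˡ↑ʳ i b =
      trans (proj₂ K-str N (toℕ i)) (cong Flip (sym (N-binary i)))
    ... | new b | old i rewrite h-↑ˡ i | h-↑ʳ b | R-↑ʳ↑ˡ b i = sym (N-binary i)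
    ... | new b | new b′ rewrite h-↑ʳ b | h-↑ʳ b′ | R-↑ʳ↑ʳ b b′ = proj₁ K-str N

  point∈𝒦⇒InCT : HasExtension Flip ℱ K → In𝒦 Flip ℱ C → InCT K n (s j)
  point∈𝒦⇒InCT ext C∈𝒦 = N , n≤N , sym N-unary , N-binary
    where
    -- B[S] lives on Fin (n + 1), the extension property on Fin (suc n)
    ι : Fin (suc n) → Fin (n + 1)
    ι = cast (+-comm 1 n)
    ι-injective : Injective _≡_ _≡_ ι
    ι-injective {a} {b} eq = toℕ-injective (trans (sym (toℕ-cast _ a)) (trans (cong toℕ eq) (toℕ-cast _ b)))
    ι-inject₁ : ∀ i → ι (inject₁ i) ≡ i ↑ˡ 1
    ι-inject₁ i = toℕ-injective (trans (toℕ-cast _ _) (trans (toℕ-inject₁ i) (sym (toℕ-↑ˡ i 1))))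
    ι-fromℕ : ι (fromℕ n) ≡ n ↑ʳ fzero
    ι-fromℕ = toℕ-injective
      (trans (toℕ-cast _ _) (trans (toℕ-fromℕ n) (sym (trans (toℕ-↑ʳ n fzero) (+-comm n 0)))))
    C′ = pullS C ι
    C′∈𝒦 : In𝒦 Flip ℱ C′
    C′∈𝒦 = In𝒦-hereditary {Flip = Flip} {ℱ = ℱ} {A = C′} {C = C}
      (pullS-isStr {Flip = Flip} {A = C} ι C-str) (pullS-embeds C ι-injective) C∈𝒦
    C′≈Kₙ : pullS C′ inject₁ ≈S pull K toℕ
    C′≈Kₙ = (λ a → trans (cong (U C) (ι-inject₁ a)) (U-↑ˡ a)) ,
            (λ a b → trans (cong₂ (R C) (ι-inject₁ a) (ι-inject₁ b)) (R-↑ˡ↑ˡ a b))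
    extension = ext n toℕ toℕ-injective C′ C′∈𝒦 C′≈Kₙ
    N = proj₁ extension
    N-realizes = proj₂ (proj₂ extension)
    n≤N : n ≤ N
    n≤N = ≮⇒≥ (λ N<n → proj₁ (proj₂ extension) (fromℕ< N<n) (toℕ-fromℕ< N<n))
    N-unary : Uω K N ≡ proj₁ (s j)
    N-unary = begin
      Uω K N                          ≡⟨ cong (Uω K) (sym (snoc-fromℕ {m = n} toℕ N)) ⟩
      Uω K (snoc toℕ N (fromℕ n))      ≡⟨ proj₁ N-realizes (fromℕ n) ⟩
      U C (ι (fromℕ n))               ≡⟨ cong (U C) ι-fromℕ ⟩
      U C (n ↑ʳ fzero)                ≡⟨ U-↑ʳ fzero ⟩
      proj₁ (s j)                     ∎
      where open ≡-Reasoning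
    N-binary : ∀ i → proj₂ (s j) i ≡ Rω K N (toℕ i)
    N-binary i = sym (begin
      Rω K N (toℕ i)
        ≡⟨ cong₂ (Rω K) (sym (snoc-fromℕ {m = n} toℕ N)) (sym (snoc-inject₁ toℕ N i)) ⟩
      Rω K (snoc toℕ N (fromℕ n)) (snoc toℕ N (inject₁ i)) ≡⟨ proj₂ N-realizes (fromℕ n) (inject₁ i) ⟩
      R C (ι (fromℕ n)) (ι (inject₁ i))                    ≡⟨ cong₂ (R C) ι-fromℕ (ι-inject₁ i) ⟩
      R C (n ↑ʳ fzero) (i ↑ˡ 1)                            ≡⟨ R-↑ʳ↑ˡ fzero i ⟩
      proj₂ (s j) i                                        ∎)
      where open ≡-Reasoning

≺lex-extend : ∀ {ku k n L} (n≤L : n ≤ L) {u u′ : Fin ku} {b b′ : Fin n → Bin k} {c c′ : Fin L → Bin k} →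
  (∀ x → c (inject≤ x n≤L) ≡ b x) → (∀ x → c′ (inject≤ x n≤L) ≡ b′ x) →
  (u , b) ≺lex (u′ , b′) → (u , c) ≺lex (u′ , c′)
≺lex-extend n≤L c≗b c′≗b′ (inj₁ u<u′) = inj₁ u<u′
≺lex-extend {n = n} n≤L {b = b} {b′} {c} {c′} c≗b c′≗b′ (inj₂ (u≡u′ , i , b≗b′ , bᵢ<b′ᵢ)) =
  inj₂ (u≡u′ , inject≤ i n≤L , c≗c′ , subst₂ _<ᶠ_ (sym (c≗b i)) (sym (c′≗b′ i)) bᵢ<b′ᵢ)
  where
  c≗c′ : ∀ x → x <ᶠ inject≤ i n≤L → c x ≡ c′ x
  c≗c′ x x<i = begin
    c x               ≡⟨ cong c (sym x≡x′) ⟩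
    c (inject≤ x′ n≤L) ≡⟨ c≗b x′ ⟩
    b x′              ≡⟨ b≗b′ x′ x′<i ⟩
    b′ x′             ≡⟨ sym (c′≗b′ x′) ⟩
    c′ (inject≤ x′ n≤L) ≡⟨ cong c′ x≡x′ ⟩
    c′ x              ∎
    where
    open ≡-Reasoning
    toℕx<toℕi : toℕ x < toℕ i
    toℕx<toℕi = subst (toℕ x <_) (toℕ-inject≤ i n≤L) x<i
    x<n : toℕ x < n
    x<n = <-trans toℕx<toℕi (toℕ<n i)
    x′ : Fin n
    x′ = fromℕ< x<n
    x≡x′ : inject≤ x′ n≤L ≡ x
    x≡x′ = toℕ-injective (trans (toℕ-inject≤ x′ n≤L) (toℕ-fromℕ< x<n))
    x′<i : x′ <ᶠ i
    x′<i = subst (_< toℕ i) (sym (toℕ-fromℕ< x<n)) toℕx<toℕi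

bound : ∀ {m} → (Fin m → ℕ) → ℕ
bound {zero} f = 0
bound {suc m} f = suc (f fzero) + bound (f ∘ fsuc)

<-bound : ∀ {m} (f : Fin m → ℕ) i → f i < bound f
<-bound f fzero = m≤m+n _ _
<-bound f (fsuc i) = <-≤-trans (<-bound (f ∘ fsuc) i) (m≤n+m _ _)

module Amalgamation
  {ku k d : ℕ} {Flip : Bin k → Bin k} {ℱ : List (FinStr ku k)} {K : InfStr ku k}
  (fl : IsFlip Flip) (irreducible : ∀ {F} → F ∈ ℱ → Irreducible (proj₂ F))
  (K-str : IsInfStr Flip K) (K-age : AgeIn𝒦 Flip ℱ K) (ext : HasExtension Flip ℱ K)
  (ρ : Fin d → Fin ku)
  {n : ℕ} (s : Fin d → Node ku k n) (s-unary : ∀ j → proj₁ (s j) ≡ ρ j)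
  {n′ : ℕ} (s′ : Fin d → Node ku k n′) (s′-unary : ∀ j → proj₁ (s′ j) ≡ ρ j) where

  private
    D = K ⊕[ n ] K

    K≈D : Kn K n ≈S Kn D n
    K≈D = (λ a → sym (⊕-U-below K n K (toℕ<n a))) ,
          (λ a b → sym (⊕-R-below K n K (toℕ<n a) (toℕ<n b)))

    D-age : ∀ t → In𝒦 Flip ℱ (Kn D t)
    D-age = ⊕-In𝒦 {Flip = Flip} {A = K} {B = K} {n = n} fl irreducible K-str K-str K-age K-age

    open EmbeddingOver (embeddingOver {Flip = Flip} {ℱ = ℱ} {K = K} ext D D-age n K≈D n′)
      renaming (map to f)

    shifted : Fin n′ → Fin (n′ + n)
    shifted b = fromℕ< (subst (n + toℕ b <_) (+-comm n n′) (+-monoʳ-< n (toℕ<n b)))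

    toℕ-shifted : ∀ b → toℕ (shifted b) ≡ n + toℕ b
    toℕ-shifted b = toℕ-fromℕ< _

  g : Fin n′ → ℕ
  g = f ∘ shifted

  g-U : ∀ b → Uω K (g b) ≡ Uω K (toℕ b)
  g-U b = begin
    Uω K (f (shifted b))        ≡⟨ proj₁ realizes (shifted b) ⟩
    Uω D (toℕ (shifted b))      ≡⟨ cong (Uω D) (toℕ-shifted b) ⟩
    Uω D (n + toℕ b)            ≡⟨ ⊕-U-above K n K (m≤m+n n _) ⟩
    Uω K (n + toℕ b ∸ n)        ≡⟨ cong (Uω K) (m+n∸m≡n n _) ⟩
    Uω K (toℕ b)                ∎
    where open ≡-Reasoning

  g-R : ∀ b b′ → Rω K (g b) (g b′) ≡ Rω K (toℕ b) (toℕ b′)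
  g-R b b′ = begin
    Rω K (f (shifted b)) (f (shifted b′))    ≡⟨ proj₂ realizes (shifted b) (shifted b′) ⟩
    Rω D (toℕ (shifted b)) (toℕ (shifted b′)) ≡⟨ cong₂ (Rω D) (toℕ-shifted b) (toℕ-shifted b′) ⟩
    Rω D (n + toℕ b) (n + toℕ b′)            ≡⟨ ⊕-R-above K n K (m≤m+n n _) (m≤m+n n _) ⟩
    Rω K (n + toℕ b ∸ n) (n + toℕ b′ ∸ n)    ≡⟨ cong₂ (Rω K) (m+n∸m≡n n _) (m+n∸m≡n n _) ⟩
    Rω K (toℕ b) (toℕ b′)                    ∎
    where open ≡-Reasoning

  g-injective : Injective _≡_ _≡_ g
  g-injective eq = toℕ-injective (+-cancelˡ-≡ n _ _
    (trans (sym (toℕ-shifted _)) (trans (cong toℕ (injective eq)) (toℕ-shifted _))))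

  g-free : ∀ (a : Fin n) b → Rω K (toℕ a) (g b) ≡ fzero
  g-free a b = begin
    Rω K (toℕ a) (f (shifted b))               ≡⟨ cong (λ x → Rω K x (f (shifted b))) (sym a-fixed) ⟩
    Rω K (f a′) (f (shifted b))                ≡⟨ proj₂ realizes a′ (shifted b) ⟩
    Rω D (toℕ a′) (toℕ (shifted b))            ≡⟨ cong₂ (Rω D) (toℕ-inject≤ a _) (toℕ-shifted b) ⟩
    Rω D (toℕ a) (n + toℕ b)                   ≡⟨ ⊕-R-below-above K n K (toℕ<n a) (m≤m+n n _) ⟩
    fzero                                      ∎
    where
    open ≡-Reasoning
    a′ : Fin (n′ + n)
    a′ = inject≤ a (m≤n+m n n′)
    a-fixed : f a′ ≡ toℕ a
    a-fixed = trans (fixes-below a′ (subst (_< n) (sym (toℕ-inject≤ a _)) (toℕ<n a))) (toℕ-inject≤ a _)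

  n≤g : ∀ b → n ≤ g b
  n≤g b = ≮⇒≥ λ gb<n →
    let i = fromℕ< (<-≤-trans gb<n (m≤n+m n n′))
        fi≡gb = trans (fixes-below i (subst (_< n) (sym (toℕ-fromℕ< _)) gb<n)) (toℕ-fromℕ< _)
        gb≡n+b = trans (sym (toℕ-fromℕ< _)) (trans (cong toℕ (injective fi≡gb)) (toℕ-shifted b))
    in <⇒≱ gb<n (subst (n ≤_) (sym gb≡n+b) (m≤m+n n _))

  L : ℕ
  L = n + bound g

  n≤L : n ≤ L
  n≤L = m≤m+n n _

  φ₁ : Fin n → Fin L
  φ₁ a = inject≤ a n≤L

  φ₂ : Fin n′ → Fin L
  φ₂ b = fromℕ< (<-≤-trans (<-bound g b) (m≤n+m _ n))

  toℕ-φ₂ : ∀ b → toℕ (φ₂ b) ≡ g b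
  toℕ-φ₂ b = toℕ-fromℕ< _

  Φ₁ : Embeds (Kn K n) (Kn K L)
  Φ₁ = φ₁ , inject≤-injective _ _ _ _ ,
       (λ a → cong (Uω K) (toℕ-inject≤ a n≤L)) ,
       (λ a b → cong₂ (Rω K) (toℕ-inject≤ a n≤L) (toℕ-inject≤ b n≤L))

  Φ₂ : Embeds (Kn K n′) (Kn K L)
  Φ₂ = φ₂ , (λ eq → g-injective (trans (sym (toℕ-φ₂ _)) (trans (cong toℕ eq) (toℕ-φ₂ _)))) ,
       (λ b → trans (cong (Uω K) (toℕ-φ₂ b)) (g-U b)) ,
       (λ b b′ → trans (cong₂ (Rω K) (toℕ-φ₂ b) (toℕ-φ₂ b′)) (g-R b b′))

  φ₁≢φ₂ : ∀ a b → φ₁ a ≢ φ₂ b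
  φ₁≢φ₂ a b eq = <⇒≱ (subst (_< n) (sym (toℕ-inject≤ a n≤L)) (toℕ<n a))
    (subst (n ≤_) (sym (trans (cong toℕ eq) (toℕ-φ₂ b))) (n≤g b))

  σ : Fin d → Fin L → Bin k
  σ j x with image? φ₁ x | image? φ₂ x
  ... | yes (a , _) | _ = proj₂ (s j) a
  ... | no _ | yes (b , _) = proj₂ (s′ j) b
  ... | no _ | no _ = fzero

  σ-φ₁ : ∀ j a → σ j (φ₁ a) ≡ proj₂ (s j) a
  σ-φ₁ j a with image? φ₁ (φ₁ a) | image? φ₂ (φ₁ a)
  ... | yes (a′ , eq) | _ = cong (proj₂ (s j)) (proj₁ (proj₂ Φ₁) eq)
  ... | no ∉φ₁ | _ = ⊥-elim (∉φ₁ (a , refl))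

  σ-φ₂ : ∀ j b → σ j (φ₂ b) ≡ proj₂ (s′ j) b
  σ-φ₂ j b with image? φ₁ (φ₂ b) | image? φ₂ (φ₂ b)
  ... | yes (a , eq) | _ = ⊥-elim (φ₁≢φ₂ a b eq)
  ... | no _ | yes (b′ , eq) = cong (proj₂ (s′ j)) (proj₁ (proj₂ Φ₂) eq)
  ... | no _ | no ∉φ₂ = ⊥-elim (∉φ₂ (b , refl))

  σ-outside : ∀ j x → ¬ Image φ₁ x → ¬ Image φ₂ x → σ j x ≡ fzero
  σ-outside j x ∉φ₁ ∉φ₂ with image? φ₁ x | image? φ₂ x
  ... | yes x∈φ₁ | _ = ⊥-elim (∉φ₁ x∈φ₁)
  ... | no _ | yes x∈φ₂ = ⊥-elim (∉φ₂ x∈φ₂)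
  ... | no _ | no _ = refl

  s⊔s′ : Fin d → Node ku k L
  s⊔s′ j = ρ j , σ j

  module _ {m : ℕ} (B : Str d k m) where

    private
      C = B[_] Flip K s⊔s′ B
      open B[]-values Flip K s⊔s′ B

    E₁ : Embeds (B[_] Flip K s B) C
    E₁ = B[]-mono B Φ₁ (sym ∘ s-unary) σ-φ₁

    E₂ : Embeds (B[_] Flip K s′ B) C
    E₂ = B[]-mono B Φ₂ (sym ∘ s′-unary) σ-φ₂

    private
      M₁ = proj₁ E₁
      M₂ = proj₁ E₂

      old↪C : Embeds (Kn K L) C
      old↪C = (_↑ˡ m) , ↑ˡ-injective m _ _ , U-↑ˡ , R-↑ˡ↑ˡ

      covered : ∀ x → Image (_↑ˡ m) x ⊎ (Image M₁ x ⊎ Image M₂ x)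
      covered x with split L x
      ... | old i = inj₁ (i , refl)
      ... | new b = inj₂ (inj₁ (n ↑ʳ b , mapOld-↑ʳ m φ₁ b))

      new-outside-unrelated : ∀ x y → Image M₁ x ⊎ Image M₂ x → ¬ Image (_↑ˡ m) x →
        Image (_↑ˡ m) y → ¬ (Image M₁ y ⊎ Image M₂ y) → R C x y ≡ fzero
      new-outside-unrelated x _ _ x-new (i , refl) i∉M with split L x
      ... | old i′ = ⊥-elim (x-new (i′ , refl))
      ... | new b = trans (R-↑ʳ↑ˡ b i) (σ-outside (U B b) i i∉φ₁ i∉φ₂)
        where
        i∉φ₁ : ¬ Image φ₁ i
        i∉φ₁ (a , refl) = i∉M (inj₁ (a ↑ˡ m , mapOld-↑ˡ m φ₁ a))
        i∉φ₂ : ¬ Image φ₂ i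
        i∉φ₂ (b′ , refl) = i∉M (inj₂ (b′ ↑ˡ m , mapOld-↑ˡ m φ₂ b′))

      φ₂-φ₁-unrelated : ∀ x y → Image M₂ x → ¬ Image M₁ x → Image M₁ y → ¬ Image M₂ y → R C x y ≡ fzero
      φ₂-φ₁-unrelated _ _ (z , refl) x∉M₁ (w , refl) y∉M₂ with split n′ z | split n w
      ... | new c | _ = ⊥-elim (x∉M₁ (n ↑ʳ c , trans (mapOld-↑ʳ m φ₁ c) (sym (mapOld-↑ʳ m φ₂ c))))
      ... | old _ | new c = ⊥-elim (y∉M₂ (n′ ↑ʳ c , trans (mapOld-↑ʳ m φ₂ c) (sym (mapOld-↑ʳ m φ₁ c))))
      ... | old b | old a = begin
        R C (M₂ (b ↑ˡ m)) (M₁ (a ↑ˡ m))          ≡⟨ cong₂ (R C) (mapOld-↑ˡ m φ₂ b) (mapOld-↑ˡ m φ₁ a) ⟩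
        R C (φ₂ b ↑ˡ m) (φ₁ a ↑ˡ m)              ≡⟨ R-↑ˡ↑ˡ (φ₂ b) (φ₁ a) ⟩
        Rω K (toℕ (φ₂ b)) (toℕ (φ₁ a))           ≡⟨ proj₂ K-str (toℕ (φ₁ a)) (toℕ (φ₂ b)) ⟩
        Flip (Rω K (toℕ (φ₁ a)) (toℕ (φ₂ b)))    ≡⟨ cong (λ y → Flip (Rω K y _)) (toℕ-inject≤ a n≤L) ⟩
        Flip (Rω K (toℕ a) (toℕ (φ₂ b)))         ≡⟨ cong (λ y → Flip (Rω K (toℕ a) y)) (toℕ-φ₂ b) ⟩
        Flip (Rω K (toℕ a) (g b))                ≡⟨ cong Flip (g-free a b) ⟩
        Flip fzero                               ≡⟨ proj₂ fl ⟩
        fzero                                    ∎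
        where open ≡-Reasoning

    merge : IsStr Flip B → In𝒦 Flip ℱ (B[_] Flip K s B) → In𝒦 Flip ℱ (B[_] Flip K s′ B) →
      In𝒦 Flip ℱ C
    merge B-str (_ , s-free) (_ , s′-free) = B[]-isStr {s = s⊔s′} fl K-str B-str , C-free
      where
      C-free : ∀ F → F ∈ ℱ → ¬ Embeds (proj₂ F) C
      C-free F F∈ E
        -- first split off K_L, then separate the two copies, which are mutually unrelated
        with Irreducible-one-side {C = C} (irreducible F∈) E (image? (_↑ˡ m))
               (λ x → image? M₁ x ⊎-dec image? M₂ x) (covered ∘ proj₁ E) new-outside-unrelated
      ... | inj₁ all-old = proj₂ (K-age L toℕ toℕ-injective) F F∈ (Embeds-factor {C = C} E old↪C all-old)
      ... | inj₂ all-φ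
        with Irreducible-one-side {C = C} (irreducible F∈) E (image? M₁) (image? M₂) all-φ φ₂-φ₁-unrelated
      ...   | inj₁ all-φ₁ = s-free F F∈ (Embeds-factor {C = C} E E₁ all-φ₁)
      ...   | inj₂ all-φ₂ = s′-free F F∈ (Embeds-factor {C = C} E E₂ all-φ₂)

    unmerge : IsStr Flip B → In𝒦 Flip ℱ C → In𝒦 Flip ℱ (B[_] Flip K s B) × In𝒦 Flip ℱ (B[_] Flip K s′ B)
    unmerge B-str C∈𝒦 = restrict E₁ , restrict E₂
      where
      restrict : ∀ {n″} {t : Fin d → Node ku k n″} →
        Embeds (B[_] Flip K t B) C → In𝒦 Flip ℱ (B[_] Flip K t B)
      restrict {t = t} E =
        In𝒦-hereditary {Flip = Flip} {ℱ = ℱ} {C = C} (B[]-isStr {s = t} fl K-str B-str) E C∈𝒦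

  𝒦[s]∩𝒦[s′]≐𝒦[s⊔s′] : (𝒦[_] Flip ℱ K s ∩ 𝒦[_] Flip ℱ K s′) ≐ 𝒦[_] Flip ℱ K s⊔s′
  𝒦[s]∩𝒦[s′]≐𝒦[s⊔s′] m B = mk⇔
    (λ { ((B-str , s∈𝒦) , (_ , s′∈𝒦)) → B-str , merge B B-str s∈𝒦 s′∈𝒦 })
    (λ { (B-str , C∈𝒦) → (B-str , proj₁ (unmerge B B-str C∈𝒦)) , (B-str , proj₂ (unmerge B B-str C∈𝒦)) })

  s⊔s′-≺lex : (∀ i j → i <ᶠ j → s i ≺lex s j) → ∀ i j → i <ᶠ j → s⊔s′ i ≺lex s⊔s′ j
  s⊔s′-≺lex s-≺lex i j i<j = subst₂ (λ u u′ → (u , σ i) ≺lex (u′ , σ j)) (s-unary i) (s-unary j)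
    (≺lex-extend n≤L (σ-φ₁ i) (σ-φ₁ j) (s-≺lex i j i<j))

  s⊔s′-InCT : (∀ j → InCT K n (s j)) → (∀ j → InCT K n′ (s′ j)) → ∀ j → InCT K L (s⊔s′ j)
  s⊔s′-InCT s-CT s′-CT j = point∈𝒦⇒InCT fl K-str s⊔s′ j ext
    (merge (point j) (point-isStr {Flip = Flip} {j = j} fl)
      (InCT⇒point∈𝒦 fl K-str s j K-age (s-CT j)) (InCT⇒point∈𝒦 fl K-str s′ j K-age (s′-CT j)))

corollary4p11 : (ku k : ℕ) (Flip : Bin k → Bin k) → IsFlip Flip →
    (ℱ : List (FinStr ku k)) →
    All (λ F → IsStr Flip (proj₂ F) × Irreducible (proj₂ F)) ℱ →
    NonDegenerate Flip ℱ →
    (K : InfStr ku k) → IsFraisseLimit Flip ℱ K → LeftDense Flip ℱ K →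
    (d : ℕ) (ρ : Fin d → Fin ku) → NonDecreasing ρ →
    (𝒜 𝓑 : Class d k) → InP Flip ℱ K ρ 𝒜 → InP Flip ℱ K ρ 𝓑 →
    InP Flip ℱ K ρ (𝒜 ∩ 𝓑)
corollary4p11 ku k Flip fl ℱ ℱ-irr _ K (K-str , K-age , _ , ext) _ d ρ _ 𝒜 𝓑
  (n , s , (s-≺lex , s-CT , s-unary) , 𝒜≐) (n′ , s′ , (_ , s′-CT , s′-unary) , 𝓑≐) =
  L , s⊔s′ , (s⊔s′-≺lex s-≺lex , s⊔s′-InCT s-CT s′-CT , λ _ → refl) ,
  λ m B → ⇔-trans (𝒜≐ m B ×-⇔ 𝓑≐ m B) (𝒦[s]∩𝒦[s′]≐𝒦[s⊔s′] m B)
  where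
  open Amalgamation {Flip = Flip} {ℱ = ℱ} {K = K}
    fl (proj₂ ∘ lookup ℱ-irr) K-str K-age ext ρ s s-unary s′ s′-unary
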